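{- Let $\mathcal{C}$ be a category with countable coproducts, $I$ an object and $F\colon\mathcal{C}\to\mathcal{C}$ a functor admitting precise factorizations with respect to the class of all morphisms. A pointed $F$-coalgebra $(C,c,i_C)$ is a tree iff it is isomorphic (as a pointed coalgebra) to the coproduct of its levels, i.e. to $\coprod_{k\in\mathbb{N}}T_k$ with structure $[F\mathsf{in}_{k+1}]_k\cdot\coprod_kt_k$ and point $\mathsf{in}_0$, where $T_0=I$, $h_0=i_C$, and for each $k$, $c\cdot h_k=Fh_{k+1}\cdot t_k$ is a precise factorization with $h_{k+1}\colon T_{k+1}\to C$ and $t_k\colon T_k\to FT_{k+1}$ $F$-precise.
   Context: A morphism $p\colon P\to FR$ is $F$-precise (w.r.t. all morphisms) if for all $f\colon P\to FC'$, $m\colon R\to D$, $h\colon C'\to D$ with $Fm\cdot p=Fh\cdot f$ there is $d\colon R\to C'$ with $Fd\cdot p=f$ and $h\cdot d=m$. $F$ admits precise factorizations if every $f\colon S\to FY$ can be written $f=Fh\cdot p$ with $p$ $F$-precise. A pointed $F$-coalgebra is $(C,c,i_C)$ with $c\colon C\to FC$, $i_C\colon I\to C$; a pointed coalgebra morphism $h\colon(T,t,i_T)\to(C,c,i_C)$ satisfies $c\cdot h=Fh\cdot t$ and $h\cdot i_T=i_C$; it is a split epimorphism of pointed coalgebras if some pointed coalgebra morphism $s$ has $h\cdot s=\mathrm{id}$. A pointed coalgebra is a tree if every pointed coalgebra morphism into it is a split epimorphism of pointed coalgebras. -}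

module Defs where

open import Level using (Level; _⊔_; suc)
open import Data.Nat using (ℕ; zero) renaming (suc to 1+)
open import Data.Product using (Σ; _×_; _,_)
open import Relation.Binary using (IsEquivalence)

record Category (o ℓ e : Level) : Set (Level.suc (o ⊔ ℓ ⊔ e)) where
  infixr 9 _∘_
  infix  4 _≈_
  field
    Obj  : Set o
    Hom  : Obj → Obj → Set ℓ
    _≈_  : ∀ {A B} → Hom A B → Hom A B → Set e
    id   : ∀ {A} → Hom A A
    _∘_  : ∀ {A B C} → Hom B C → Hom A B → Hom A C
    equiv     : ∀ {A B} → IsEquivalence (_≈_ {A} {B})
    assoc     : ∀ {A B C D} {f : Hom A B} {g : Hom B C} {h : Hom C D} →
                (h ∘ g) ∘ f ≈ h ∘ (g ∘ f)
    identityˡ : ∀ {A B} {f : Hom A B} → id ∘ f ≈ f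
    identityʳ : ∀ {A B} {f : Hom A B} → f ∘ id ≈ f
    ∘-resp-≈  : ∀ {A B C} {f h : Hom B C} {g i : Hom A B} →
                f ≈ h → g ≈ i → f ∘ g ≈ h ∘ i

record Endofunctor {o ℓ e} (𝒞 : Category o ℓ e) : Set (o ⊔ ℓ ⊔ e) where
  open Category 𝒞
  field
    F₀ : Obj → Obj
    F₁ : ∀ {A B} → Hom A B → Hom (F₀ A) (F₀ B)
    identity     : ∀ {A} → F₁ (id {A}) ≈ id
    homomorphism : ∀ {A B C} {f : Hom A B} {g : Hom B C} →
                   F₁ (g ∘ f) ≈ F₁ g ∘ F₁ f
    F-resp-≈     : ∀ {A B} {f g : Hom A B} → f ≈ g → F₁ f ≈ F₁ g

record CountableCoproducts {o ℓ e} (𝒞 : Category o ℓ e) : Set (o ⊔ ℓ ⊔ e) where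
  open Category 𝒞
  field
    ∐     : (ℕ → Obj) → Obj
    inj   : ∀ {A : ℕ → Obj} (k : ℕ) → Hom (A k) (∐ A)
    [_]   : ∀ {A : ℕ → Obj} {X} → ((k : ℕ) → Hom (A k) X) → Hom (∐ A) X
    commute : ∀ {A : ℕ → Obj} {X} (f : (k : ℕ) → Hom (A k) X) (k : ℕ) →
              [ f ] ∘ inj k ≈ f k
    unique  : ∀ {A : ℕ → Obj} {X} (f : (k : ℕ) → Hom (A k) X) (g : Hom (∐ A) X) →
              ((k : ℕ) → g ∘ inj k ≈ f k) → g ≈ [ f ]

  ∐₁ : ∀ {A B : ℕ → Obj} → ((k : ℕ) → Hom (A k) (B k)) → Hom (∐ A) (∐ B)
  ∐₁ f = [ (λ k → inj k ∘ f k) ]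

module Precise {o ℓ e} (𝒞 : Category o ℓ e) (F : Endofunctor 𝒞) where
  open Category 𝒞
  open Endofunctor F

  IsPrecise : ∀ {P R} → Hom P (F₀ R) → Set (o ⊔ ℓ ⊔ e)
  IsPrecise {P} {R} p =
    ∀ {C' D} (f : Hom P (F₀ C')) (m : Hom R D) (h : Hom C' D) →
    F₁ m ∘ p ≈ F₁ h ∘ f →
    Σ (Hom R C') λ d → (F₁ d ∘ p ≈ f) × (h ∘ d ≈ m)

  AdmitsPreciseFactorizations : Set (o ⊔ ℓ ⊔ e)
  AdmitsPreciseFactorizations =
    ∀ {S Y} (f : Hom S (F₀ Y)) →
    Σ Obj λ R → Σ (Hom R Y) λ h → Σ (Hom S (F₀ R)) λ p →
      IsPrecise p × (f ≈ F₁ h ∘ p)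

module Pointed {o ℓ e} (𝒞 : Category o ℓ e) (F : Endofunctor 𝒞) (I : Category.Obj 𝒞) where
  open Category 𝒞
  open Endofunctor F

  record PointedCoalgebra : Set (o ⊔ ℓ) where
    field
      Carrier   : Obj
      structure : Hom Carrier (F₀ Carrier)
      point     : Hom I Carrier
  open PointedCoalgebra public

  record PCMorphism (A B : PointedCoalgebra) : Set (ℓ ⊔ e) where
    field
      hom        : Hom (Carrier A) (Carrier B)
      comm       : structure B ∘ hom ≈ F₁ hom ∘ structure A
      preserves-point : hom ∘ point A ≈ point B
  open PCMorphism public

  IsSplitEpi : ∀ {A B} → PCMorphism A B → Set (ℓ ⊔ e)
  IsSplitEpi {A} {B} h = Σ (PCMorphism B A) λ s → hom h ∘ hom s ≈ id

  IsTree : PointedCoalgebra → Set (o ⊔ ℓ ⊔ e)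
  IsTree C = ∀ (T : PointedCoalgebra) (h : PCMorphism T C) → IsSplitEpi h

  record _≅_ (A B : PointedCoalgebra) : Set (ℓ ⊔ e) where
    field
      from    : PCMorphism A B
      to      : PCMorphism B A
      isoˡ    : hom to ∘ hom from ≈ id
      isoʳ    : hom from ∘ hom to ≈ id

module LevelsOf {o ℓ e} (𝒞 : Category o ℓ e) (cp : CountableCoproducts 𝒞)
                (F : Endofunctor 𝒞) (I : Category.Obj 𝒞) where
  open Category 𝒞
  open Endofunctor F
  open CountableCoproducts cp
  open Precise 𝒞 F
  open Pointed 𝒞 F I

  levelObj : (ℕ → Obj) → ℕ → Obj
  levelObj T⁺ zero   = I
  levelObj T⁺ (1+ k) = T⁺ k

  levelHom : (C : PointedCoalgebra) (T⁺ : ℕ → Obj) →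
             ((k : ℕ) → Hom (T⁺ k) (Carrier C)) →
             (k : ℕ) → Hom (levelObj T⁺ k) (Carrier C)
  levelHom C T⁺ h⁺ zero   = point C
  levelHom C T⁺ h⁺ (1+ k) = h⁺ k

  record Levels (C : PointedCoalgebra) : Set (o ⊔ ℓ ⊔ e) where
    field
      T⁺ : ℕ → Obj                          -- T⁺ k = T_{k+1}
      h⁺ : (k : ℕ) → Hom (T⁺ k) (Carrier C) -- h⁺ k = h_{k+1}

    T : ℕ → Obj
    T = levelObj T⁺

    h : (k : ℕ) → Hom (T k) (Carrier C)
    h = levelHom C T⁺ h⁺

    field
      t         : (k : ℕ) → Hom (T k) (F₀ (T (1+ k)))
      factorize : (k : ℕ) → structure C ∘ h k ≈ F₁ (h (1+ k)) ∘ t k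
      precise   : (k : ℕ) → IsPrecise (t k)

    coproductOfLevels : PointedCoalgebra
    coproductOfLevels = record
      { Carrier   = ∐ T
      ; structure = [ (λ k → F₁ (inj {T} (1+ k))) ] ∘ ∐₁ {T} {λ k → F₀ (T (1+ k))} t
      ; point     = inj {T} zero
      }

{-# OPTIONS --safe #-}
module Submission where

open import Defs
open import Level using (Level)
open import Function.Bundles using (_⇔_; mk⇔)
open import Data.Nat using (ℕ; zero) renaming (suc to 1+)
open import Data.Product using (Σ; _×_; _,_; proj₁; proj₂)
open import Relation.Binary using (IsEquivalence; Setoid)
import Relation.Binary.Reasoning.Setoid as SetoidReasoning

-- The coproduct D of the levels is always a tree: a section of a morphism
-- g into D is built level by level, the precision of tₖ lifting injₖ₊₁
-- through g once injₖ has been lifted.  The levels hₖ assemble to a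
-- morphism D → C.  If C is a tree, this morphism has a section, which in
-- turn has a section because D is a tree; so it is an isomorphism.
-- Conversely, a retract of a tree is a tree.

module HomReasoning {o ℓ e} (𝒞 : Category o ℓ e) where
  open Category 𝒞

  hom-setoid : Obj → Obj → Setoid ℓ e
  hom-setoid A B = record { isEquivalence = equiv {A} {B} }

  open module Reasoning {A B : Obj} = SetoidReasoning (hom-setoid A B) public
  open module Equiv {A B : Obj} = IsEquivalence (equiv {A} {B}) public
    using () renaming (refl to ≈-refl; sym to ≈-sym; trans to ≈-trans)

  ∘-resp-≈ˡ : ∀ {A B C} {f h : Hom B C} {g : Hom A B} → f ≈ h → f ∘ g ≈ h ∘ g
  ∘-resp-≈ˡ f≈h = ∘-resp-≈ f≈h ≈-refl

  ∘-resp-≈ʳ : ∀ {A B C} {f h : Hom A B} {g : Hom B C} → f ≈ h → g ∘ f ≈ g ∘ h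
  ∘-resp-≈ʳ f≈h = ∘-resp-≈ ≈-refl f≈h

  left-inverse≈right-inverse : ∀ {A B} {h r : Hom B A} {s : Hom A B} →
                               h ∘ s ≈ id → s ∘ r ≈ id → h ≈ r
  left-inverse≈right-inverse {h = h} {r} {s} h∘s≈id s∘r≈id = begin
    h             ≈⟨ identityʳ ⟨
    h ∘ id        ≈⟨ ∘-resp-≈ʳ s∘r≈id ⟨
    h ∘ (s ∘ r)   ≈⟨ assoc ⟨
    (h ∘ s) ∘ r   ≈⟨ ∘-resp-≈ˡ h∘s≈id ⟩
    id ∘ r        ≈⟨ identityˡ ⟩
    r             ∎

module CoproductLemmas {o ℓ e} (𝒞 : Category o ℓ e) (cp : CountableCoproducts 𝒞) where
  open Category 𝒞
  open CountableCoproducts cp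
  open HomReasoning 𝒞

  inj-jointly-epic : ∀ {A : ℕ → Obj} {X} (f g : Hom (∐ A) X) →
                     ((k : ℕ) → f ∘ inj k ≈ g ∘ inj k) → f ≈ g
  inj-jointly-epic f g f∘inj≈g∘inj = begin
    f                     ≈⟨ unique (λ k → g ∘ inj k) f f∘inj≈g∘inj ⟩
    [ (λ k → g ∘ inj k) ] ≈⟨ unique (λ k → g ∘ inj k) g (λ _ → ≈-refl) ⟨
    g                     ∎

module Trees {o ℓ e} (𝒞 : Category o ℓ e) (F : Endofunctor 𝒞) (I : Category.Obj 𝒞) where
  open Category 𝒞
  open Endofunctor F
  open Pointed 𝒞 F I
  open HomReasoning 𝒞

  infixr 9 _∘ᴾ_
  _∘ᴾ_ : ∀ {A B C} → PCMorphism B C → PCMorphism A B → PCMorphism A C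
  _∘ᴾ_ {A} {B} {C} g f = record
    { hom = hom g ∘ hom f
    ; comm = begin
        structure C ∘ (hom g ∘ hom f)          ≈⟨ assoc ⟨
        (structure C ∘ hom g) ∘ hom f          ≈⟨ ∘-resp-≈ˡ (comm g) ⟩
        (F₁ (hom g) ∘ structure B) ∘ hom f     ≈⟨ assoc ⟩
        F₁ (hom g) ∘ (structure B ∘ hom f)     ≈⟨ ∘-resp-≈ʳ (comm f) ⟩
        F₁ (hom g) ∘ (F₁ (hom f) ∘ structure A) ≈⟨ assoc ⟨
        (F₁ (hom g) ∘ F₁ (hom f)) ∘ structure A ≈⟨ ∘-resp-≈ˡ homomorphism ⟨
        F₁ (hom g ∘ hom f) ∘ structure A       ∎
    ; preserves-point = begin
        (hom g ∘ hom f) ∘ point A  ≈⟨ assoc ⟩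
        hom g ∘ (hom f ∘ point A)  ≈⟨ ∘-resp-≈ʳ (preserves-point f) ⟩
        hom g ∘ point B            ≈⟨ preserves-point g ⟩
        point C                    ∎
    }

  retract-of-tree : ∀ {C D} (r : PCMorphism D C) (s : PCMorphism C D) →
                    hom r ∘ hom s ≈ id → IsTree D → IsTree C
  retract-of-tree {C} {D} r s r∘s≈id D-tree A h = σ ∘ᴾ s , h∘σ∘s≈id
    where
    σ : PCMorphism D A
    σ = proj₁ (D-tree A (s ∘ᴾ h))

    s∘h∘σ≈id : (hom s ∘ hom h) ∘ hom σ ≈ id
    s∘h∘σ≈id = proj₂ (D-tree A (s ∘ᴾ h))

    h∘σ∘s≈id : hom h ∘ (hom σ ∘ hom s) ≈ id
    h∘σ∘s≈id = begin
      hom h ∘ (hom σ ∘ hom s)                    ≈⟨ identityˡ ⟨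
      id ∘ (hom h ∘ (hom σ ∘ hom s))             ≈⟨ ∘-resp-≈ˡ r∘s≈id ⟨
      (hom r ∘ hom s) ∘ (hom h ∘ (hom σ ∘ hom s)) ≈⟨ assoc ⟩
      hom r ∘ (hom s ∘ (hom h ∘ (hom σ ∘ hom s))) ≈⟨ ∘-resp-≈ʳ (∘-resp-≈ʳ assoc) ⟨
      hom r ∘ (hom s ∘ ((hom h ∘ hom σ) ∘ hom s)) ≈⟨ ∘-resp-≈ʳ assoc ⟨
      hom r ∘ ((hom s ∘ (hom h ∘ hom σ)) ∘ hom s) ≈⟨ ∘-resp-≈ʳ (∘-resp-≈ˡ assoc) ⟨
      hom r ∘ (((hom s ∘ hom h) ∘ hom σ) ∘ hom s) ≈⟨ ∘-resp-≈ʳ (∘-resp-≈ˡ s∘h∘σ≈id) ⟩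
      hom r ∘ (id ∘ hom s)                       ≈⟨ ∘-resp-≈ʳ identityˡ ⟩
      hom r ∘ hom s                              ≈⟨ r∘s≈id ⟩
      id                                         ∎

  morphism-of-trees-is-iso : ∀ {C D} → IsTree C → IsTree D → PCMorphism D C → C ≅ D
  morphism-of-trees-is-iso {C} {D} C-tree D-tree H = record
    { from = S ; to = H ; isoˡ = H∘S≈id ; isoʳ = S∘H≈id }
    where
    S : PCMorphism C D
    S = proj₁ (C-tree D H)

    H∘S≈id : hom H ∘ hom S ≈ id
    H∘S≈id = proj₂ (C-tree D H)

    R : PCMorphism D C
    R = proj₁ (D-tree C S)

    S∘R≈id : hom S ∘ hom R ≈ id
    S∘R≈id = proj₂ (D-tree C S)

    S∘H≈id : hom S ∘ hom H ≈ id
    S∘H≈id = begin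
      hom S ∘ hom H  ≈⟨ ∘-resp-≈ʳ (left-inverse≈right-inverse H∘S≈id S∘R≈id) ⟩
      hom S ∘ hom R  ≈⟨ S∘R≈id ⟩
      id             ∎

module LevelCoproduct {o ℓ e} (𝒞 : Category o ℓ e) (cp : CountableCoproducts 𝒞)
    (F : Endofunctor 𝒞) (I : Category.Obj 𝒞)
    {C : Pointed.PointedCoalgebra 𝒞 F I} (L : LevelsOf.Levels 𝒞 cp F I C) where
  open Category 𝒞
  open Endofunctor F
  open CountableCoproducts cp
  open Pointed 𝒞 F I
  open LevelsOf.Levels L
  open HomReasoning 𝒞
  open CoproductLemmas 𝒞 cp

  D : PointedCoalgebra
  D = coproductOfLevels

  structure-inj : (k : ℕ) → structure D ∘ inj k ≈ F₁ (inj (1+ k)) ∘ t k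
  structure-inj k = begin
    ([ (λ j → F₁ (inj (1+ j))) ] ∘ ∐₁ t) ∘ inj k   ≈⟨ assoc ⟩
    [ (λ j → F₁ (inj (1+ j))) ] ∘ (∐₁ t ∘ inj k)   ≈⟨ ∘-resp-≈ʳ (commute _ k) ⟩
    [ (λ j → F₁ (inj (1+ j))) ] ∘ (inj k ∘ t k)    ≈⟨ assoc ⟨
    ([ (λ j → F₁ (inj (1+ j))) ] ∘ inj k) ∘ t k    ≈⟨ ∘-resp-≈ˡ (commute _ k) ⟩
    F₁ (inj (1+ k)) ∘ t k                          ∎

  copair-morphism : (A : PointedCoalgebra) (g : (k : ℕ) → Hom (T k) (Carrier A)) →
                    g zero ≈ point A →
                    ((k : ℕ) → structure A ∘ g k ≈ F₁ (g (1+ k)) ∘ t k) →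
                    PCMorphism D A
  copair-morphism A g g₀≈point g-coalg = record
    { hom = [ g ]
    ; comm = inj-jointly-epic _ _ λ k → begin
        (structure A ∘ [ g ]) ∘ inj k             ≈⟨ assoc ⟩
        structure A ∘ ([ g ] ∘ inj k)             ≈⟨ ∘-resp-≈ʳ (commute g k) ⟩
        structure A ∘ g k                         ≈⟨ g-coalg k ⟩
        F₁ (g (1+ k)) ∘ t k                       ≈⟨ ∘-resp-≈ˡ (F-resp-≈ (commute g (1+ k))) ⟨
        F₁ ([ g ] ∘ inj (1+ k)) ∘ t k             ≈⟨ ∘-resp-≈ˡ homomorphism ⟩
        (F₁ [ g ] ∘ F₁ (inj (1+ k))) ∘ t k        ≈⟨ assoc ⟩
        F₁ [ g ] ∘ (F₁ (inj (1+ k)) ∘ t k)        ≈⟨ ∘-resp-≈ʳ (structure-inj k) ⟨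
        F₁ [ g ] ∘ (structure D ∘ inj k)          ≈⟨ assoc ⟨
        (F₁ [ g ] ∘ structure D) ∘ inj k          ∎
    ; preserves-point = ≈-trans (commute g zero) g₀≈point
    }

  levels-morphism : PCMorphism D C
  levels-morphism = copair-morphism C h ≈-refl factorize

  coproductOfLevels-isTree : IsTree D
  coproductOfLevels-isTree A g = copair-morphism A lift ≈-refl lift-coalg , g∘[lift]≈id
    where
    lift-next : (k : ℕ) (s : Hom (T k) (Carrier A)) → hom g ∘ s ≈ inj k →
                Σ (Hom (T (1+ k)) (Carrier A)) λ d →
                  (F₁ d ∘ t k ≈ structure A ∘ s) × (hom g ∘ d ≈ inj (1+ k))
    lift-next k s g∘s≈inj = precise k (structure A ∘ s) (inj (1+ k)) (hom g) (begin
      F₁ (inj (1+ k)) ∘ t k                ≈⟨ structure-inj k ⟨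
      structure D ∘ inj k                  ≈⟨ ∘-resp-≈ʳ g∘s≈inj ⟨
      structure D ∘ (hom g ∘ s)            ≈⟨ assoc ⟨
      (structure D ∘ hom g) ∘ s            ≈⟨ ∘-resp-≈ˡ (comm g) ⟩
      (F₁ (hom g) ∘ structure A) ∘ s       ≈⟨ assoc ⟩
      F₁ (hom g) ∘ (structure A ∘ s)       ∎)

    lift : (k : ℕ) → Hom (T k) (Carrier A)
    g∘lift≈inj : (k : ℕ) → hom g ∘ lift k ≈ inj k

    lift zero = point A
    lift (1+ k) = proj₁ (lift-next k (lift k) (g∘lift≈inj k))

    g∘lift≈inj zero = preserves-point g
    g∘lift≈inj (1+ k) = proj₂ (proj₂ (lift-next k (lift k) (g∘lift≈inj k)))

    lift-coalg : (k : ℕ) → structure A ∘ lift k ≈ F₁ (lift (1+ k)) ∘ t k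
    lift-coalg k = ≈-sym (proj₁ (proj₂ (lift-next k (lift k) (g∘lift≈inj k))))

    g∘[lift]≈id : hom g ∘ [ lift ] ≈ id
    g∘[lift]≈id = inj-jointly-epic _ _ λ k → begin
      (hom g ∘ [ lift ]) ∘ inj k  ≈⟨ assoc ⟩
      hom g ∘ ([ lift ] ∘ inj k)  ≈⟨ ∘-resp-≈ʳ (commute lift k) ⟩
      hom g ∘ lift k              ≈⟨ g∘lift≈inj k ⟩
      inj k                       ≈⟨ identityˡ ⟨
      id ∘ inj k                  ∎

-- Precise factorizations are only needed for levels to exist; here they are given.
corollary5p20 : ∀ {o ℓ e : Level} (𝒞 : Category o ℓ e) (cp : CountableCoproducts 𝒞)
                  (I : Category.Obj 𝒞) (F : Endofunctor 𝒞) →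
                  Precise.AdmitsPreciseFactorizations 𝒞 F →
                  (C : Pointed.PointedCoalgebra 𝒞 F I) →
                  (L : LevelsOf.Levels 𝒞 cp F I C) →
                  Pointed.IsTree 𝒞 F I C ⇔
                    Pointed._≅_ 𝒞 F I C (LevelsOf.Levels.coproductOfLevels L)
corollary5p20 𝒞 cp I F _ C L = mk⇔
  (λ C-tree → morphism-of-trees-is-iso C-tree coproductOfLevels-isTree levels-morphism)
  (λ C≅D → retract-of-tree (_≅_.to C≅D) (_≅_.from C≅D) (_≅_.isoˡ C≅D) coproductOfLevels-isTree)
  where
  open Pointed 𝒞 F I using (_≅_)
  open Trees 𝒞 F I
  open LevelCoproduct 𝒞 cp F I L
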